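{- Let $\Lambda$ be a finite distributive lattice, let $E\in\Lambda$ be meet-irreducible and $F\in\Lambda$ with $E\le F$. Let $\mathcal A^*$ be the class of finite structures $(A,d,<_E)$ such that $(A,d)$ is a $\Lambda$-ultrametric space and $<_E$ is a subquotient order on $A$ with bottom relation $E$ and top relation $F$. Then $\mathcal A^*$ is an amalgamation class.
   Context: A $\Lambda$-ultrametric space is a set $A$ with $d:A\times A\to\Lambda$, symmetric, $d(x,y)=\mathbf 0$ iff $x=y$, and $d(x,z)\le d(x,y)\vee d(y,z)$. Each $\lambda\in\Lambda$ determines the equivalence relation $\{(x,y):d(x,y)\le\lambda\}$, also denoted $\lambda$. A subquotient order from $E$ to $F$ (for equivalence relations $E\le F$) is a partial order on $A/E$ in which two $E$-classes are comparable iff they lie in the same $F$-class, pulled back to $A$. An element $E$ of $\Lambda$ is meet-irreducible if $E\ne\mathbf 1$ and $E=a\wedge b$ implies $E=a$ or $E=b$. An amalgamation class is a class of finite structures closed under isomorphism and substructures, with the joint embedding and amalgamation properties. -}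

module Defs where

open import Level using (0ℓ)
open import Data.Nat using (ℕ)
open import Data.Fin using (Fin)
open import Data.Bool using (Bool; true; false)
open import Data.Product using (Σ; ∃; _×_; _,_)
open import Data.Sum using (_⊎_)
open import Relation.Nullary using (¬_)
open import Relation.Binary.PropositionalEquality using (_≡_) renaming (setoid to ≡-setoid)
open import Relation.Binary.Lattice.Bundles using (DistributiveLattice)
open import Function.Bundles using (Inverse)
open import Function.Definitions using (Injective)

record FiniteDistLattice : Set₁ where
  field
    lat    : DistributiveLattice 0ℓ 0ℓ 0ℓ
  open DistributiveLattice lat public
  field
    size   : ℕ
    finite : Inverse (≡-setoid (Fin size)) setoid

module _ (Λ : FiniteDistLattice) where
  open FiniteDistLattice Λ

  IsBottom : Carrier → Set
  IsBottom z = ∀ w → z ≤ w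

  IsTop : Carrier → Set
  IsTop z = ∀ w → w ≤ z

  MeetIrreducible : Carrier → Set
  MeetIrreducible E = ¬ IsTop E × (∀ a b → E ≈ a ∧ b → E ≈ a ⊎ E ≈ b)

  record Str : Set where
    field
      n  : ℕ
      d  : Fin n → Fin n → Carrier
      lt : Fin n → Fin n → Bool

  open Str

  IsUltrametric : Str → Set
  IsUltrametric A =
      (∀ x y → d A x y ≈ d A y x)
    × (∀ x y → IsBottom (d A x y) → x ≡ y)
    × (∀ x y → x ≡ y → IsBottom (d A x y))
    × (∀ x y z → d A x z ≤ d A x y ∨ d A y z)

  Rel[_]_ : Carrier → (A : Str) → Fin (n A) → Fin (n A) → Set
  (Rel[ l ] A) x y = d A x y ≤ l

  -- < is a subquotient order from E to F: it is the pull-back to A of a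
  -- (strict) partial order on A/E in which two E-classes are comparable
  -- iff they lie in the same F-class.
  IsSubquotientOrder : Carrier → Carrier → Str → Set
  IsSubquotientOrder E F A =
      (∀ x x' y y' → (Rel[ E ] A) x x' → (Rel[ E ] A) y y' →
         lt A x y ≡ true → lt A x' y' ≡ true)
    × (∀ x y → (Rel[ E ] A) x y → lt A x y ≡ false)
    × (∀ x y z → lt A x y ≡ true → lt A y z ≡ true → lt A x z ≡ true)
    × (∀ x y → lt A x y ≡ true → (Rel[ F ] A) x y)
    × (∀ x y → (Rel[ F ] A) x y → ¬ (Rel[ E ] A) x y →
         lt A x y ≡ true ⊎ lt A y x ≡ true)

  record Emb (A B : Str) : Set where
    field
      f     : Fin (n A) → Fin (n B)
      inj   : Injective _≡_ _≡_ f
      d-pres  : ∀ x y → d B (f x) (f y) ≈ d A x y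
      lt-pres : ∀ x y → lt B (f x) (f y) ≡ lt A x y

  Iso : Str → Str → Set
  Iso A B = Σ (Emb A B) λ e → ∀ y → ∃ λ x → Emb.f e x ≡ y

  Class : Set₁
  Class = Str → Set

  ClosedUnderIso : Class → Set
  ClosedUnderIso K = ∀ A B → Iso A B → K A → K B

  Hereditary : Class → Set
  Hereditary K = ∀ A B → Emb A B → K B → K A

  JEP : Class → Set
  JEP K = ∀ A B → K A → K B → Σ Str λ C → K C × Emb A C × Emb B C

  AP : Class → Set
  AP K = ∀ A B C → K A → K B → K C → (f : Emb A B) → (g : Emb A C) →
    Σ Str λ D → K D × Σ (Emb B D) λ f' → Σ (Emb C D) λ g' →
      (∀ x → Emb.f f' (Emb.f f x) ≡ Emb.f g' (Emb.f g x))

  IsAmalgamationClass : Class → Set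
  IsAmalgamationClass K = ClosedUnderIso K × Hereditary K × JEP K × AP K

  𝒜* : Carrier → Carrier → Class
  𝒜* E F A = IsUltrametric A × IsSubquotientOrder E F A

module Submission where

-- Given B ← A → C in 𝒜*, give B ⊔ C the largest distance allowed by the ultrametric inequality
-- through A, δ(b,c) = ⋀ₐ d(b,fa) ∨ d(ga,c), and glue points at distance 𝟎.  As E is
-- meet-irreducible in a distributive lattice it is meet-prime, so δ(b,c) ≤ E forces b and c to be
-- E-equivalent to the images of one point of A.  This is what lets the orders of B and C be merged
-- across the two sides into a subquotient order from E to F.  JEP is amalgamation over ∅.

open import Defs

open import Level using (0ℓ)
open import Data.Nat using (ℕ; zero; suc)
open import Data.Fin using (Fin; zero; suc; splitAt; join)
open import Data.Fin.Properties using (any?; all?; suc-injective; splitAt-join) renaming (_≟_ to _≟ᶠ_)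
open import Data.Product using (∃; _×_; _,_; proj₁; proj₂)
open import Data.Sum using (_⊎_; inj₁; inj₂)
import Data.Sum as Sum
open import Data.Empty using (⊥-elim)
open import Data.Bool using (true; false)
open import Data.Bool.Properties using (¬-not; not-¬) renaming (_≟_ to _≟ᵇ_)
open import Function using (_∘_)
open import Relation.Nullary using (¬_; Dec; yes; no; does)
open import Relation.Nullary.Decidable using (map′; via-injection; dec-true; does-⇔; _⊎-dec_; _×-dec_; ¬?)
open import Function.Definitions using (Injective)
open import Function.Bundles using (Inverse; Equivalence; _⇔_; mk⇔)
open import Function.Properties.Inverse using (Inverse⇒Injection)
import Function.Construct.Symmetry as Symmetry
import Relation.Binary.Construct.On as On
import Relation.Binary.Reasoning.PartialOrder as ≤-Reasoning
import Relation.Binary.Lattice.Properties.DistributiveLattice as DistributiveLatticeProperties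
import Relation.Binary.Lattice.Properties.JoinSemilattice as JoinSemilatticeProperties
open import Relation.Binary.Core using (Rel)
open import Relation.Binary.Definitions using (Decidable)
open import Relation.Binary.Structures using (IsDecEquivalence)
open import Relation.Binary.PropositionalEquality using (_≡_; refl; sym; trans; cong; cong₂; subst₂)

record Quotient {T : Set} (R : Rel T 0ℓ) : Set where
  field
    card     : ℕ
    [_]      : T → Fin card
    rep      : Fin card → T
    [rep]    : ∀ i → [ rep i ] ≡ i
    sound    : ∀ {x y} → [ x ] ≡ [ y ] → R x y
    complete : ∀ {x y} → R x y → [ x ] ≡ [ y ]

does-true⇒ : {P : Set} (p? : Dec P) → does p? ≡ true → P
does-true⇒ (yes p) _ = p

does-≟-true : ∀ b → does (b ≟ᵇ true) ≡ b
does-≟-true true  = refl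
does-≟-true false = refl

finQuotient : ∀ {N} {R : Rel (Fin N) 0ℓ} → IsDecEquivalence R → Quotient R
finQuotient {zero} _ = record
  { card = 0 ; [_] = λ () ; rep = λ () ; [rep] = λ () ; sound = λ { {()} } ; complete = λ { {()} } }
finQuotient {suc N} {R} R-isDecEq with any? (λ y → zero ≟ suc y)
  where open IsDecEquivalence R-isDecEq using (_≟_)
... | yes (y₀ , 0Ry₀) = record
  { card = Q.card ; [_] = cls ; rep = suc ∘ Q.rep ; [rep] = Q.[rep] ; sound = sound′ ; complete = complete′ }
  where
  open IsDecEquivalence R-isDecEq renaming (refl to R-refl; sym to R-sym; trans to R-trans)
  module Q = Quotient (finQuotient (On.isDecEquivalence suc R-isDecEq))
  cls : Fin (suc N) → Fin Q.card
  cls zero    = Q.[ y₀ ]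
  cls (suc x) = Q.[ x ]
  sound′ : ∀ {x y} → cls x ≡ cls y → R x y
  sound′ {zero}  {zero}  _ = R-refl
  sound′ {zero}  {suc y} e = R-trans 0Ry₀ (Q.sound e)
  sound′ {suc x} {zero}  e = R-trans (Q.sound e) (R-sym 0Ry₀)
  sound′ {suc x} {suc y} e = Q.sound e
  complete′ : ∀ {x y} → R x y → cls x ≡ cls y
  complete′ {zero}  {zero}  _ = refl
  complete′ {zero}  {suc y} r = Q.complete (R-trans (R-sym 0Ry₀) r)
  complete′ {suc x} {zero}  r = Q.complete (R-trans r 0Ry₀)
  complete′ {suc x} {suc y} r = Q.complete r
... | no 0≁later = record
  { card = suc Q.card ; [_] = cls ; rep = rep′ ; [rep] = [rep]′ ; sound = sound′ ; complete = complete′ }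
  where
  open IsDecEquivalence R-isDecEq renaming (refl to R-refl; sym to R-sym; trans to R-trans)
  module Q = Quotient (finQuotient (On.isDecEquivalence suc R-isDecEq))
  cls : Fin (suc N) → Fin (suc Q.card)
  cls zero    = zero
  cls (suc x) = suc Q.[ x ]
  rep′ : Fin (suc Q.card) → Fin (suc N)
  rep′ zero    = zero
  rep′ (suc i) = suc (Q.rep i)
  [rep]′ : ∀ i → cls (rep′ i) ≡ i
  [rep]′ zero    = refl
  [rep]′ (suc i) = cong suc (Q.[rep] i)
  sound′ : ∀ {x y} → cls x ≡ cls y → R x y
  sound′ {zero}  {zero}  _ = R-refl
  sound′ {suc x} {suc y} e = Q.sound (suc-injective e)
  complete′ : ∀ {x y} → R x y → cls x ≡ cls y
  complete′ {zero}  {zero}  _ = refl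
  complete′ {zero}  {suc y} r = ⊥-elim (0≁later (y , r))
  complete′ {suc x} {zero}  r = ⊥-elim (0≁later (x , R-sym r))
  complete′ {suc x} {suc y} r = cong suc (Q.complete r)

enumeratedQuotient : ∀ {T : Set} {N} {R : Rel T 0ℓ} (enum : Fin N → T) (index : T → Fin N) →
  (∀ t → enum (index t) ≡ t) → IsDecEquivalence R → Quotient R
enumeratedQuotient {T} {N} {R} enum index enum-index R-isDecEq = record
  { card = Q.card ; [_] = Q.[_] ∘ index ; rep = enum ∘ Q.rep ; [rep] = [rep]′
  ; sound = λ {x} {y} e → subst₂ R (enum-index x) (enum-index y) (Q.sound e)
  ; complete = λ {x} {y} r → Q.complete (subst₂ R (sym (enum-index x)) (sym (enum-index y)) r) }
  where
  open IsDecEquivalence R-isDecEq using () renaming (refl to R-refl)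
  module Q = Quotient (finQuotient (On.isDecEquivalence enum R-isDecEq))
  [rep]′ : ∀ i → Q.[ index (enum (Q.rep i)) ] ≡ i
  [rep]′ i = trans (Q.complete (subst₂ R (sym (enum-index _)) refl R-refl)) (Q.[rep] i)

module _ (Λ : FiniteDistLattice) where
  open FiniteDistLattice Λ
    renaming (refl to ≤-refl; trans to ≤-trans; reflexive to ≤-reflexive; antisym to ≤-antisym)
  open DistributiveLatticeProperties lat using (∨-distribˡ-∧)
  open JoinSemilatticeProperties joinSemilattice using (x≤y⇒x∨y≈y; ∨-monotonic; ∨-comm; ∨-assoc)

  x≤y⇒x≤y∨z : ∀ {x y z} → x ≤ y → x ≤ y ∨ z
  x≤y⇒x≤y∨z x≤y = ≤-trans x≤y (x≤x∨y _ _)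

  x≤z⇒x≤y∨z : ∀ {x y z} → x ≤ z → x ≤ y ∨ z
  x≤z⇒x≤y∨z x≤z = ≤-trans x≤z (y≤x∨y _ _)

  _≈?_ : Decidable _≈_
  _≈?_ = via-injection (Inverse⇒Injection (Symmetry.inverse finite)) _≟ᶠ_

  _≤?_ : Decidable _≤_
  x ≤? y = map′ (λ x∨y≈y → ≤-trans (x≤x∨y x y) (≤-reflexive x∨y≈y)) x≤y⇒x∨y≈y ((x ∨ y) ≈? y)

  isBottom? : ∀ z → Dec (IsBottom Λ z)
  isBottom? z = map′ (λ z≤all w → ≤-trans (z≤all (from w)) (≤-reflexive (strictlyInverseˡ w)))
                     (λ z≤all i → z≤all (to i))
                     (all? (λ i → z ≤? to i))
    where open Inverse finite using (to; from; strictlyInverseˡ)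

  ⋁ : Carrier → (k : ℕ) → (Fin k → Carrier) → Carrier
  ⋁ x zero    t = x
  ⋁ x (suc k) t = t zero ∨ ⋁ x k (t ∘ suc)

  ≤⋁ : ∀ x k t (i : Fin k) → t i ≤ ⋁ x k t
  ≤⋁ x (suc k) t zero    = x≤x∨y _ _
  ≤⋁ x (suc k) t (suc i) = x≤z⇒x≤y∨z (≤⋁ x k (t ∘ suc) i)

  -- The join of all elements; the argument only witnesses that Λ is inhabited.
  ⊤ : Carrier → Carrier
  ⊤ x = ⋁ x size to
    where open Inverse finite using (to)

  ⊤-isTop : ∀ x → IsTop Λ (⊤ x)
  ⊤-isTop x w = ≤-trans (≤-reflexive (Eq.sym (strictlyInverseˡ w))) (≤⋁ x size to (from w))
    where open Inverse finite using (to; from; strictlyInverseˡ)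

  meetIrreducible⇒meetPrime : ∀ {E} → MeetIrreducible Λ E → ∀ {x y} → x ∧ y ≤ E → x ≤ E ⊎ y ≤ E
  meetIrreducible⇒meetPrime {E} (_ , irreducible) {x} {y} x∧y≤E
    with irreducible (E ∨ x) (E ∨ y) E≈[E∨x]∧[E∨y]
    where
    E≈[E∨x]∧[E∨y] : E ≈ (E ∨ x) ∧ (E ∨ y)
    E≈[E∨x]∧[E∨y] = Eq.trans (≤-antisym (x≤x∨y _ _) (∨-least ≤-refl x∧y≤E)) (∨-distribˡ-∧ E x y)
  ... | inj₁ E≈E∨x = inj₁ (≤-trans (y≤x∨y E x) (≤-reflexive (Eq.sym E≈E∨x)))
  ... | inj₂ E≈E∨y = inj₂ (≤-trans (y≤x∨y E y) (≤-reflexive (Eq.sym E≈E∨y)))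

  module FiniteMeets (top : Carrier) (top-isTop : IsTop Λ top) where

    ⋀ : (k : ℕ) → (Fin k → Carrier) → Carrier
    ⋀ zero    t = top
    ⋀ (suc k) t = t zero ∧ ⋀ k (t ∘ suc)

    ⋀≤ : ∀ k t (i : Fin k) → ⋀ k t ≤ t i
    ⋀≤ (suc k) t zero    = x∧y≤x _ _
    ⋀≤ (suc k) t (suc i) = ≤-trans (x∧y≤y _ _) (⋀≤ k (t ∘ suc) i)

    ≤∨⋀ : ∀ {x y} k t → (∀ i → y ≤ x ∨ t i) → y ≤ x ∨ ⋀ k t
    ≤∨⋀         zero    t _     = x≤z⇒x≤y∨z (top-isTop _)
    ≤∨⋀ {x} {y} (suc k) t y≤x∨t =
      ≤-trans (∧-greatest (y≤x∨t zero) (≤∨⋀ k (t ∘ suc) (y≤x∨t ∘ suc)))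
              (≤-reflexive (Eq.sym (∨-distribˡ-∧ x (t zero) (⋀ k (t ∘ suc)))))

    ≤⋀∨ : ∀ {x y} k t → (∀ i → y ≤ t i ∨ x) → y ≤ ⋀ k t ∨ x
    ≤⋀∨ {x} {y} k t y≤t∨x =
      ≤-trans (≤∨⋀ k t (λ i → ≤-trans (y≤t∨x i) (≤-reflexive (∨-comm (t i) x))))
              (≤-reflexive (∨-comm x (⋀ k t)))

    ⋀≤meetIrreducible : ∀ {E} → MeetIrreducible Λ E → ∀ k t → ⋀ k t ≤ E → ∃ λ i → t i ≤ E
    ⋀≤meetIrreducible (E≉top , _) zero t top≤E = ⊥-elim (E≉top (λ w → ≤-trans (top-isTop w) top≤E))
    ⋀≤meetIrreducible E-irr (suc k) t ⋀≤E with meetIrreducible⇒meetPrime E-irr ⋀≤E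
    ... | inj₁ t₀≤E = zero , t₀≤E
    ... | inj₂ ⋀′≤E = let i , tᵢ≤E = ⋀≤meetIrreducible E-irr k (t ∘ suc) ⋀′≤E in suc i , tᵢ≤E

  -- Distance 𝟎 is allowed between distinct points, and ⊏ need not be stated to respect
  -- E-classes: that follows from the other axioms (⊏-respˡ-∼E, ⊏-respʳ-∼E).
  record IsOrderedPseudoUltrametric {T : Set} (E F : Carrier) (d : T → T → Carrier) (_⊏_ : T → T → Set) : Set where
    field
      d-sym      : ∀ x y → d x y ≈ d y x
      d-refl     : ∀ x → IsBottom Λ (d x x)
      d-triangle : ∀ x y z → d x z ≤ d x y ∨ d y z
      ⊏-irrefl   : ∀ {x y} → d x y ≤ E → ¬ x ⊏ y
      ⊏-trans    : ∀ {x y z} → x ⊏ y → y ⊏ z → x ⊏ z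
      ⊏⇒≤F       : ∀ {x y} → x ⊏ y → d x y ≤ F
      ⊏-total    : ∀ {x y} → d x y ≤ F → ¬ d x y ≤ E → x ⊏ y ⊎ y ⊏ x

    _∼[_]_ : T → Carrier → T → Set
    x ∼[ l ] y = d x y ≤ l

    ∼-refl : ∀ l x → x ∼[ l ] x
    ∼-refl l x = d-refl x l

    ∼-sym : ∀ {l x y} → x ∼[ l ] y → y ∼[ l ] x
    ∼-sym {x = x} {y} x∼y = ≤-trans (≤-reflexive (d-sym y x)) x∼y

    ∼-trans : ∀ {l x y z} → x ∼[ l ] y → y ∼[ l ] z → x ∼[ l ] z
    ∼-trans {x = x} {y} {z} x∼y y∼z = ≤-trans (d-triangle x y z) (∨-least x∼y y∼z)

    _≐_ : T → T → Set
    x ≐ y = IsBottom Λ (d x y)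

    ≐-isDecEquivalence : IsDecEquivalence _≐_
    ≐-isDecEquivalence = record
      { isEquivalence = record
        { refl  = λ {x} → d-refl x
        ; sym   = λ x≐y l → ∼-sym (x≐y l)
        ; trans = λ x≐y y≐z l → ∼-trans (x≐y l) (y≐z l) }
      ; _≟_ = λ x y → isBottom? (d x y) }

    d-cong-≐ : ∀ {x x′ y y′} → x ≐ x′ → y ≐ y′ → d x y ≈ d x′ y′
    d-cong-≐ {x} {x′} {y} {y′} x≐x′ y≐y′ = ≤-antisym (d-≤ x≐x′ y≐y′) (d-≤ (sym′ x≐x′) (sym′ y≐y′))
      where
      open IsDecEquivalence ≐-isDecEquivalence using () renaming (sym to sym′)
      d-≤ : ∀ {x x′ y y′} → x ≐ x′ → y ≐ y′ → d x y ≤ d x′ y′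
      d-≤ {x} {x′} {y} {y′} x≐x′ y≐y′ = ≤-trans (d-triangle x x′ y)
        (∨-least (x≐x′ _) (≤-trans (d-triangle x′ y′ y) (∨-least ≤-refl (∼-sym (y≐y′ _)))))

    _⊑_ : T → T → Set
    x ⊑ y = x ⊏ y ⊎ x ∼[ E ] y

    ⊑-decidable : Decidable _⊏_ → Decidable _⊑_
    ⊑-decidable _⊏?_ x y = (x ⊏? y) ⊎-dec (d x y ≤? E)

  module OrderedPseudoUltrametricProperties
    {E F} (E≤F : E ≤ F) {T : Set} {d : T → T → Carrier} {_⊏_ : T → T → Set}
    (S : IsOrderedPseudoUltrametric E F d _⊏_) where
    open IsOrderedPseudoUltrametric S

    ∼E⇒∼F : ∀ {x y} → x ∼[ E ] y → x ∼[ F ] y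
    ∼E⇒∼F x∼y = ≤-trans x∼y E≤F

    -- Moving x inside its E-class keeps it F-related to y and not E-related,
    -- so totality forces one of the two comparisons, and the wrong one creates a cycle.
    ⊏-respˡ-∼E : ∀ {x x′ y} → x ∼[ E ] x′ → x ⊏ y → x′ ⊏ y
    ⊏-respˡ-∼E x∼x′ x⊏y
      with ⊏-total (∼-trans (∼E⇒∼F (∼-sym x∼x′)) (⊏⇒≤F x⊏y))
                   (λ x′∼y → ⊏-irrefl (∼-trans x∼x′ x′∼y) x⊏y)
    ... | inj₁ x′⊏y = x′⊏y
    ... | inj₂ y⊏x′ = ⊥-elim (⊏-irrefl x∼x′ (⊏-trans x⊏y y⊏x′))

    ⊏-respʳ-∼E : ∀ {x y y′} → y ∼[ E ] y′ → x ⊏ y → x ⊏ y′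
    ⊏-respʳ-∼E y∼y′ x⊏y
      with ⊏-total (∼-trans (⊏⇒≤F x⊏y) (∼E⇒∼F y∼y′))
                   (λ x∼y′ → ⊏-irrefl (∼-trans x∼y′ (∼-sym y∼y′)) x⊏y)
    ... | inj₁ x⊏y′ = x⊏y′
    ... | inj₂ y′⊏x = ⊥-elim (⊏-irrefl (∼-sym y∼y′) (⊏-trans y′⊏x x⊏y))

    ⊑-⊏-trans : ∀ {x y z} → x ⊑ y → y ⊏ z → x ⊏ z
    ⊑-⊏-trans (inj₁ x⊏y) y⊏z = ⊏-trans x⊏y y⊏z
    ⊑-⊏-trans (inj₂ x∼y) y⊏z = ⊏-respˡ-∼E (∼-sym x∼y) y⊏z

    ⊏-⊑-trans : ∀ {x y z} → x ⊏ y → y ⊑ z → x ⊏ z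
    ⊏-⊑-trans x⊏y (inj₁ y⊏z) = ⊏-trans x⊏y y⊏z
    ⊏-⊑-trans x⊏y (inj₂ y∼z) = ⊏-respʳ-∼E y∼z x⊏y

    ⊑-trans : ∀ {x y z} → x ⊑ y → y ⊑ z → x ⊑ z
    ⊑-trans (inj₁ x⊏y) y⊑z        = inj₁ (⊏-⊑-trans x⊏y y⊑z)
    ⊑-trans (inj₂ x∼y) (inj₁ y⊏z) = inj₁ (⊑-⊏-trans (inj₂ x∼y) y⊏z)
    ⊑-trans (inj₂ x∼y) (inj₂ y∼z) = inj₂ (∼-trans x∼y y∼z)

    ⊑⇒≯ : ∀ {x y} → x ⊑ y → ¬ y ⊏ x
    ⊑⇒≯ {x} x⊑y y⊏x = ⊏-irrefl (∼-refl E x) (⊑-⊏-trans x⊑y y⊏x)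

    ⊏-or-⊒ : ∀ {x y} → x ∼[ F ] y → x ⊏ y ⊎ y ⊑ x
    ⊏-or-⊒ {x} {y} x∼y with d x y ≤? E
    ... | yes x∼Ey = inj₂ (inj₂ (∼-sym x∼Ey))
    ... | no  x≁Ey = Sum.map₂ inj₁ (⊏-total x∼y x≁Ey)

  Lt : (X : Str Λ) → Fin (Str.n X) → Fin (Str.n X) → Set
  Lt X x y = Str.lt X x y ≡ true

  Lt? : ∀ X → Decidable (Lt X)
  Lt? X x y = Str.lt X x y ≟ᵇ true

  𝒜*⇒isOrderedPseudoUltrametric : ∀ {E F} X → 𝒜* Λ E F X →
    IsOrderedPseudoUltrametric E F (Str.d X) (Lt X)
  𝒜*⇒isOrderedPseudoUltrametric X ((d-sym , _ , ≡⇒bottom , d-triangle) , (_ , irrefl , trans′ , ⊏⇒≤F , total)) = record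
    { d-sym      = d-sym
    ; d-refl     = λ x → ≡⇒bottom x x refl
    ; d-triangle = d-triangle
    ; ⊏-irrefl   = λ x∼y → not-¬ (irrefl _ _ x∼y)
    ; ⊏-trans    = trans′ _ _ _
    ; ⊏⇒≤F       = ⊏⇒≤F _ _
    ; ⊏-total    = total _ _ }

  isOrderedPseudoUltrametric⇒𝒜* : ∀ {E F} → E ≤ F → ∀ X →
    IsOrderedPseudoUltrametric E F (Str.d X) (Lt X) →
    (∀ x y → IsBottom Λ (Str.d X x y) → x ≡ y) → 𝒜* Λ E F X
  isOrderedPseudoUltrametric⇒𝒜* E≤F X S bottom⇒≡ =
      (d-sym , bottom⇒≡ , (λ { x .x refl → d-refl x }) , d-triangle)
    , ( (λ x x′ y y′ x∼x′ y∼y′ x⊏y → ⊏-respʳ-∼E y∼y′ (⊏-respˡ-∼E x∼x′ x⊏y))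
      , (λ x y x∼y → ¬-not (⊏-irrefl x∼y))
      , (λ x y z → ⊏-trans)
      , (λ x y → ⊏⇒≤F)
      , (λ x y → ⊏-total) )
    where
    open IsOrderedPseudoUltrametric S
    open OrderedPseudoUltrametricProperties E≤F S

  pullback : ∀ {E F} {S T : Set} {d′ : S → S → Carrier} {d : T → T → Carrier}
    {_⊏′_ : S → S → Set} {_⊏_ : T → T → Set} (φ : S → T) →
    (∀ x y → d′ x y ≈ d (φ x) (φ y)) → (∀ {x y} → x ⊏′ y ⇔ φ x ⊏ φ y) →
    IsOrderedPseudoUltrametric E F d _⊏_ → IsOrderedPseudoUltrametric E F d′ _⊏′_
  pullback {d′ = d′} {d} φ d′≈d ⊏′⇔⊏ S = record
    { d-sym      = λ x y → Eq.trans (d′≈d x y) (Eq.trans (d-sym _ _) (Eq.sym (d′≈d y x)))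
    ; d-refl     = λ x l → to-d′ (d-refl (φ x) l)
    ; d-triangle = λ x y z → ≤-trans (to-d′ (d-triangle (φ x) (φ y) (φ z)))
                                     (∨-monotonic (≤-reflexive (Eq.sym (d′≈d x y)))
                                                  (≤-reflexive (Eq.sym (d′≈d y z))))
    ; ⊏-irrefl   = λ x∼y x⊏′y → ⊏-irrefl (to-d x∼y) (to ⊏′⇔⊏ x⊏′y)
    ; ⊏-trans    = λ x⊏′y y⊏′z → from ⊏′⇔⊏ (⊏-trans (to ⊏′⇔⊏ x⊏′y) (to ⊏′⇔⊏ y⊏′z))
    ; ⊏⇒≤F       = λ x⊏′y → to-d′ (⊏⇒≤F (to ⊏′⇔⊏ x⊏′y))
    ; ⊏-total    = λ x∼y x≁y → Sum.map (from ⊏′⇔⊏) (from ⊏′⇔⊏) (⊏-total (to-d x∼y) (x≁y ∘ to-d′)) }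
    where
    open IsOrderedPseudoUltrametric S
    open Equivalence using (to; from)
    to-d : ∀ {x y l} → d′ x y ≤ l → d (φ x) (φ y) ≤ l
    to-d {x} {y} = ≤-trans (≤-reflexive (Eq.sym (d′≈d x y)))
    to-d′ : ∀ {x y l} → d (φ x) (φ y) ≤ l → d′ x y ≤ l
    to-d′ {x} {y} = ≤-trans (≤-reflexive (d′≈d x y))

  𝒜*-pullback : ∀ {E F} → E ≤ F → ∀ X Y (φ : Fin (Str.n X) → Fin (Str.n Y)) → Injective _≡_ _≡_ φ →
    (∀ x x′ → Str.d X x x′ ≈ Str.d Y (φ x) (φ x′)) → (∀ x x′ → Str.lt X x x′ ≡ Str.lt Y (φ x) (φ x′)) →
    𝒜* Λ E F Y → 𝒜* Λ E F X
  𝒜*-pullback E≤F X Y φ φ-injective d≈ lt≡ Y∈𝒜* =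
    isOrderedPseudoUltrametric⇒𝒜* E≤F X
      (pullback φ d≈ (λ {x} {y} → mk⇔ (trans (sym (lt≡ x y))) (trans (lt≡ x y)))
                (𝒜*⇒isOrderedPseudoUltrametric Y Y∈𝒜*))
      (λ x y x≐y → φ-injective (bottom⇒≡ (φ x) (φ y) (λ l → ≤-trans (≤-reflexive (Eq.sym (d≈ x y))) (x≐y l))))
    where
    bottom⇒≡ : ∀ y y′ → IsBottom Λ (Str.d Y y y′) → y ≡ y′
    bottom⇒≡ = proj₁ (proj₂ (proj₁ Y∈𝒜*))

  module QuotientStructure {E F} (E≤F : E ≤ F) {T : Set} {N : ℕ}
    (enum : Fin N → T) (index : T → Fin N) (enum-index : ∀ t → enum (index t) ≡ t)
    {d : T → T → Carrier} {_⊏_ : T → T → Set}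
    (S : IsOrderedPseudoUltrametric E F d _⊏_) (_⊏?_ : Decidable _⊏_) where
    open IsOrderedPseudoUltrametric S
    open OrderedPseudoUltrametricProperties E≤F S
    private module Q = Quotient (enumeratedQuotient enum index enum-index ≐-isDecEquivalence)
    open Q public using ([_]) renaming (sound to []-sound; complete to []-complete)

    D : Str Λ
    D = record { n = Q.card ; d = λ i j → d (Q.rep i) (Q.rep j) ; lt = λ i j → does (Q.rep i ⊏? Q.rep j) }

    D∈𝒜* : 𝒜* Λ E F D
    D∈𝒜* = isOrderedPseudoUltrametric⇒𝒜* E≤F D
      (pullback Q.rep (λ _ _ → Eq.refl) (mk⇔ (does-true⇒ (_ ⊏? _)) (dec-true (_ ⊏? _))) S)
      (λ i j i≐j → trans (sym (Q.[rep] i)) (trans (Q.complete i≐j) (Q.[rep] j)))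

    rep[]≐ : ∀ t → Q.rep [ t ] ≐ t
    rep[]≐ t = Q.sound (Q.[rep] [ t ])

    d-[] : ∀ x y → Str.d D [ x ] [ y ] ≈ d x y
    d-[] x y = d-cong-≐ (rep[]≐ x) (rep[]≐ y)

    lt-[] : ∀ x y → Str.lt D [ x ] [ y ] ≡ does (x ⊏? y)
    lt-[] x y = does-⇔ (mk⇔ (⊏-resp (rep[]≐ x) (rep[]≐ y)) (⊏-resp (≐-sym (rep[]≐ x)) (≐-sym (rep[]≐ y)))) (Q.rep [ x ] ⊏? Q.rep [ y ]) (x ⊏? y)
      where
      open IsDecEquivalence ≐-isDecEquivalence using () renaming (sym to ≐-sym)
      ⊏-resp : ∀ {x x′ y y′} → x ≐ x′ → y ≐ y′ → x ⊏ y → x′ ⊏ y′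
      ⊏-resp x≐x′ y≐y′ x⊏y = ⊏-respʳ-∼E (y≐y′ E) (⊏-respˡ-∼E (x≐x′ E) x⊏y)

  module Amalgamation {E F} (E-irr : MeetIrreducible Λ E) (E≤F : E ≤ F) (A B C : Str Λ)
    (B∈𝒜* : 𝒜* Λ E F B) (C∈𝒜* : 𝒜* Λ E F C) (f : Emb Λ A B) (g : Emb Λ A C) where
    open FiniteMeets (⊤ E) (⊤-isTop E)
    open ≤-Reasoning poset

    module Bᵒ where
      open IsOrderedPseudoUltrametric (𝒜*⇒isOrderedPseudoUltrametric B B∈𝒜*) public
      open OrderedPseudoUltrametricProperties E≤F (𝒜*⇒isOrderedPseudoUltrametric B B∈𝒜*) public

    module Cᵒ where
      open IsOrderedPseudoUltrametric (𝒜*⇒isOrderedPseudoUltrametric C C∈𝒜*) public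
      open OrderedPseudoUltrametricProperties E≤F (𝒜*⇒isOrderedPseudoUltrametric C C∈𝒜*) public

    open Str A using () renaming (n to nA)
    open Str B using () renaming (n to nB; d to dB)
    open Str C using () renaming (n to nC; d to dC)
    open Emb f using () renaming (f to φ)
    open Emb g using () renaming (f to ψ)

    dφ≈dψ : ∀ a a′ → dB (φ a) (φ a′) ≈ dC (ψ a) (ψ a′)
    dφ≈dψ a a′ = Eq.trans (Emb.d-pres f a a′) (Eq.sym (Emb.d-pres g a a′))

    φ⊏⇒ψ⊏ : ∀ {a a′} → Lt B (φ a) (φ a′) → Lt C (ψ a) (ψ a′)
    φ⊏⇒ψ⊏ {a} {a′} φa⊏φa′ = trans (Emb.lt-pres g a a′) (trans (sym (Emb.lt-pres f a a′)) φa⊏φa′)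

    φ⊑⇒ψ⊑ : ∀ {a a′} → φ a Bᵒ.⊑ φ a′ → ψ a Cᵒ.⊑ ψ a′
    φ⊑⇒ψ⊑ (inj₁ φa⊏φa′) = inj₁ (φ⊏⇒ψ⊏ φa⊏φa′)
    φ⊑⇒ψ⊑ {a} {a′} (inj₂ φa∼φa′) = inj₂ (≤-trans (≤-reflexive (Eq.sym (dφ≈dψ a a′))) φa∼φa′)

    δ : Fin nB → Fin nC → Carrier
    δ b c = ⋀ nA (λ a → dB b (φ a) ∨ dC (ψ a) c)

    δ≤ : ∀ b c a → δ b c ≤ dB b (φ a) ∨ dC (ψ a) c
    δ≤ b c = ⋀≤ nA (λ a → dB b (φ a) ∨ dC (ψ a) c)

    δ≤E⇒ : ∀ {b c} → δ b c ≤ E → ∃ λ a → b Bᵒ.∼[ E ] φ a × ψ a Cᵒ.∼[ E ] c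
    δ≤E⇒ {b} {c} δ≤E =
      let a , via≤E = ⋀≤meetIrreducible E-irr nA (λ a → dB b (φ a) ∨ dC (ψ a) c) δ≤E
      in a , ≤-trans (x≤x∨y _ _) via≤E , ≤-trans (y≤x∨y _ _) via≤E

    δ-triangleᴮ : ∀ b b′ c → δ b c ≤ dB b b′ ∨ δ b′ c
    δ-triangleᴮ b b′ c = ≤∨⋀ nA _ λ a → begin
      δ b c                                  ≤⟨ δ≤ b c a ⟩
      dB b (φ a) ∨ dC (ψ a) c                ≤⟨ ∨-monotonic (Bᵒ.d-triangle b b′ (φ a)) ≤-refl ⟩
      (dB b b′ ∨ dB b′ (φ a)) ∨ dC (ψ a) c   ≈⟨ ∨-assoc _ _ _ ⟩
      dB b b′ ∨ (dB b′ (φ a) ∨ dC (ψ a) c)   ∎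

    δ-triangleᶜ : ∀ b c c′ → δ b c′ ≤ δ b c ∨ dC c c′
    δ-triangleᶜ b c c′ = ≤⋀∨ nA _ λ a → begin
      δ b c′                                 ≤⟨ δ≤ b c′ a ⟩
      dB b (φ a) ∨ dC (ψ a) c′               ≤⟨ ∨-monotonic ≤-refl (Cᵒ.d-triangle (ψ a) c c′) ⟩
      dB b (φ a) ∨ (dC (ψ a) c ∨ dC c c′)    ≈⟨ Eq.sym (∨-assoc _ _ _) ⟩
      (dB b (φ a) ∨ dC (ψ a) c) ∨ dC c c′    ∎

    dB≤δ∨δ : ∀ b b′ c → dB b b′ ≤ δ b c ∨ δ b′ c
    dB≤δ∨δ b b′ c = ≤⋀∨ nA _ λ a → ≤∨⋀ nA _ λ a′ →
      ≤-trans (Bᵒ.d-triangle b (φ a) b′)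
        (∨-least (x≤y⇒x≤y∨z (x≤x∨y _ _))
                 (≤-trans (Bᵒ.d-triangle (φ a) (φ a′) b′)
                          (∨-least (through-c a a′) (x≤z⇒x≤y∨z (x≤y⇒x≤y∨z (≤-reflexive (Bᵒ.d-sym _ _)))))))
      where
      through-c : ∀ a a′ → dB (φ a) (φ a′) ≤ (dB b (φ a) ∨ dC (ψ a) c) ∨ (dB b′ (φ a′) ∨ dC (ψ a′) c)
      through-c a a′ = begin
        dB (φ a) (φ a′)              ≈⟨ dφ≈dψ a a′ ⟩
        dC (ψ a) (ψ a′)              ≤⟨ Cᵒ.d-triangle (ψ a) c (ψ a′) ⟩
        dC (ψ a) c ∨ dC c (ψ a′)     ≤⟨ ∨-monotonic (y≤x∨y _ _) (x≤z⇒x≤y∨z (≤-reflexive (Cᵒ.d-sym c (ψ a′)))) ⟩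
        (dB b (φ a) ∨ dC (ψ a) c) ∨ (dB b′ (φ a′) ∨ dC (ψ a′) c) ∎

    dC≤δ∨δ : ∀ b c c′ → dC c c′ ≤ δ b c ∨ δ b c′
    dC≤δ∨δ b c c′ = ≤⋀∨ nA _ λ a → ≤∨⋀ nA _ λ a′ →
      ≤-trans (Cᵒ.d-triangle c (ψ a) c′)
        (∨-least (x≤y⇒x≤y∨z (x≤z⇒x≤y∨z (≤-reflexive (Cᵒ.d-sym c (ψ a)))))
                 (≤-trans (Cᵒ.d-triangle (ψ a) (ψ a′) c′)
                          (∨-least (through-b a a′) (x≤z⇒x≤y∨z (y≤x∨y _ _)))))
      where
      through-b : ∀ a a′ → dC (ψ a) (ψ a′) ≤ (dB b (φ a) ∨ dC (ψ a) c) ∨ (dB b (φ a′) ∨ dC (ψ a′) c′)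
      through-b a a′ = begin
        dC (ψ a) (ψ a′)              ≈⟨ Eq.sym (dφ≈dψ a a′) ⟩
        dB (φ a) (φ a′)              ≤⟨ Bᵒ.d-triangle (φ a) b (φ a′) ⟩
        dB (φ a) b ∨ dB b (φ a′)     ≤⟨ ∨-monotonic (x≤y⇒x≤y∨z (≤-reflexive (Bᵒ.d-sym (φ a) b))) (x≤x∨y _ _) ⟩
        (dB b (φ a) ∨ dC (ψ a) c) ∨ (dB b (φ a′) ∨ dC (ψ a′) c′) ∎

    P : Set
    P = Fin nB ⊎ Fin nC

    dᴾ : P → P → Carrier
    dᴾ (inj₁ b) (inj₁ b′) = dB b b′
    dᴾ (inj₁ b) (inj₂ c)  = δ b c
    dᴾ (inj₂ c) (inj₁ b)  = δ b c
    dᴾ (inj₂ c) (inj₂ c′) = dC c c′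

    dᴾ-sym : ∀ x y → dᴾ x y ≈ dᴾ y x
    dᴾ-sym (inj₁ b) (inj₁ b′) = Bᵒ.d-sym b b′
    dᴾ-sym (inj₁ b) (inj₂ c)  = Eq.refl
    dᴾ-sym (inj₂ c) (inj₁ b)  = Eq.refl
    dᴾ-sym (inj₂ c) (inj₂ c′) = Cᵒ.d-sym c c′

    dᴾ-refl : ∀ x → IsBottom Λ (dᴾ x x)
    dᴾ-refl (inj₁ b) = Bᵒ.d-refl b
    dᴾ-refl (inj₂ c) = Cᵒ.d-refl c

    dᴾ-triangle : ∀ x y z → dᴾ x z ≤ dᴾ x y ∨ dᴾ y z
    dᴾ-triangle (inj₁ b) (inj₁ b′) (inj₁ b″) = Bᵒ.d-triangle b b′ b″
    dᴾ-triangle (inj₁ b) (inj₁ b′) (inj₂ c)  = δ-triangleᴮ b b′ c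
    dᴾ-triangle (inj₁ b) (inj₂ c)  (inj₁ b′) = dB≤δ∨δ b b′ c
    dᴾ-triangle (inj₁ b) (inj₂ c)  (inj₂ c′) = δ-triangleᶜ b c c′
    dᴾ-triangle (inj₂ c) (inj₁ b)  (inj₁ b′) =
      ≤-trans (δ-triangleᴮ b′ b c) (≤-trans (≤-reflexive (∨-comm _ _)) (∨-monotonic ≤-refl (≤-reflexive (Bᵒ.d-sym b′ b))))
    dᴾ-triangle (inj₂ c) (inj₁ b)  (inj₂ c′) = dC≤δ∨δ b c c′
    dᴾ-triangle (inj₂ c) (inj₂ c′) (inj₁ b)  =
      ≤-trans (δ-triangleᶜ b c′ c) (≤-trans (≤-reflexive (∨-comm _ _)) (∨-monotonic (≤-reflexive (Cᵒ.d-sym c′ c)) ≤-refl))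
    dᴾ-triangle (inj₂ c) (inj₂ c′) (inj₂ c″) = Cᵒ.d-triangle c c′ c″

    _◁_ : Fin nC → Fin nB → Set
    c ◁ b = ∃ λ a → c Cᵒ.⊑ ψ a × φ a Bᵒ.⊑ b

    _◁?_ : Decidable _◁_
    c ◁? b = any? λ a → Cᵒ.⊑-decidable (Lt? C) c (ψ a) ×-dec Bᵒ.⊑-decidable (Lt? B) (φ a) b

    ◁-⊑ᴮ : ∀ {c b b′} → c ◁ b → b Bᵒ.⊑ b′ → c ◁ b′
    ◁-⊑ᴮ (a , c⊑ψa , φa⊑b) b⊑b′ = a , c⊑ψa , Bᵒ.⊑-trans φa⊑b b⊑b′

    ⊑ᶜ-◁ : ∀ {c′ c b} → c′ Cᵒ.⊑ c → c ◁ b → c′ ◁ b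
    ⊑ᶜ-◁ c′⊑c (a , c⊑ψa , φa⊑b) = a , Cᵒ.⊑-trans c′⊑c c⊑ψa , φa⊑b

    δ≤E⇒◁ : ∀ {b c} → δ b c ≤ E → c ◁ b
    δ≤E⇒◁ δ≤E = let a , b∼φa , ψa∼c = δ≤E⇒ δ≤E in a , inj₂ (Cᵒ.∼-sym ψa∼c) , inj₂ (Bᵒ.∼-sym b∼φa)

    -- In both lemmas an E-equivalence through A would reverse the order that A inherits from B and C.
    ◁-⊏ᴮ⇒δ≰E : ∀ {c b b′} → c ◁ b → Lt B b b′ → ¬ δ b′ c ≤ E
    ◁-⊏ᴮ⇒δ≰E (a , c⊑ψa , φa⊑b) b⊏b′ δ≤E =
      let a′ , b′∼φa′ , ψa′∼c = δ≤E⇒ δ≤E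
      in Cᵒ.⊑⇒≯ (Cᵒ.⊑-trans (inj₂ ψa′∼c) c⊑ψa)
                (φ⊏⇒ψ⊏ (Bᵒ.⊑-⊏-trans φa⊑b (Bᵒ.⊏-⊑-trans b⊏b′ (inj₂ b′∼φa′))))

    ⊏ᶜ-◁⇒δ≰E : ∀ {c′ c b} → Lt C c′ c → c ◁ b → ¬ δ b c′ ≤ E
    ⊏ᶜ-◁⇒δ≰E c′⊏c (a , c⊑ψa , φa⊑b) δ≤E =
      let a′ , b∼φa′ , ψa′∼c′ = δ≤E⇒ δ≤E
      in Cᵒ.⊑⇒≯ (φ⊑⇒ψ⊑ (Bᵒ.⊑-trans φa⊑b (inj₂ b∼φa′)))
                (Cᵒ.⊑-⊏-trans (inj₂ ψa′∼c′) (Cᵒ.⊏-⊑-trans c′⊏c c⊑ψa))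

    -- Across the two sides, c goes below b exactly when A forces it (c ◁ b), and b below c otherwise.
    _⊏ᴾ_ : P → P → Set
    inj₁ b ⊏ᴾ inj₁ b′ = Lt B b b′
    inj₁ b ⊏ᴾ inj₂ c  = δ b c ≤ F × ¬ c ◁ b
    inj₂ c ⊏ᴾ inj₁ b  = δ b c ≤ F × c ◁ b × ¬ δ b c ≤ E
    inj₂ c ⊏ᴾ inj₂ c′ = Lt C c c′

    _⊏ᴾ?_ : Decidable _⊏ᴾ_
    inj₁ b ⊏ᴾ? inj₁ b′ = Lt? B b b′
    inj₁ b ⊏ᴾ? inj₂ c  = (δ b c ≤? F) ×-dec ¬? (c ◁? b)
    inj₂ c ⊏ᴾ? inj₁ b  = (δ b c ≤? F) ×-dec (c ◁? b) ×-dec ¬? (δ b c ≤? E)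
    inj₂ c ⊏ᴾ? inj₂ c′ = Lt? C c c′

    ⊏ᴾ-irrefl : ∀ {x y} → dᴾ x y ≤ E → ¬ x ⊏ᴾ y
    ⊏ᴾ-irrefl {inj₁ b} {inj₁ b′} b∼b′ b⊏b′         = Bᵒ.⊏-irrefl b∼b′ b⊏b′
    ⊏ᴾ-irrefl {inj₁ b} {inj₂ c}  δ≤E  (_ , c⋪b)     = c⋪b (δ≤E⇒◁ δ≤E)
    ⊏ᴾ-irrefl {inj₂ c} {inj₁ b}  δ≤E  (_ , _ , δ≰E) = δ≰E δ≤E
    ⊏ᴾ-irrefl {inj₂ c} {inj₂ c′} c∼c′ c⊏c′         = Cᵒ.⊏-irrefl c∼c′ c⊏c′

    ⊏ᴾ⇒≤F : ∀ {x y} → x ⊏ᴾ y → dᴾ x y ≤ F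
    ⊏ᴾ⇒≤F {inj₁ b} {inj₁ b′} b⊏b′ = Bᵒ.⊏⇒≤F b⊏b′
    ⊏ᴾ⇒≤F {inj₁ b} {inj₂ c}  (δ≤F , _) = δ≤F
    ⊏ᴾ⇒≤F {inj₂ c} {inj₁ b}  (δ≤F , _) = δ≤F
    ⊏ᴾ⇒≤F {inj₂ c} {inj₂ c′} c⊏c′ = Cᵒ.⊏⇒≤F c⊏c′

    ⊏ᴾ-total : ∀ {x y} → dᴾ x y ≤ F → ¬ dᴾ x y ≤ E → x ⊏ᴾ y ⊎ y ⊏ᴾ x
    ⊏ᴾ-total {inj₁ b} {inj₁ b′} = Bᵒ.⊏-total
    ⊏ᴾ-total {inj₁ b} {inj₂ c} δ≤F δ≰E with c ◁? b
    ... | yes c◁b = inj₂ (δ≤F , c◁b , δ≰E)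
    ... | no  c⋪b = inj₁ (δ≤F , c⋪b)
    ⊏ᴾ-total {inj₂ c} {inj₁ b} δ≤F δ≰E with c ◁? b
    ... | yes c◁b = inj₁ (δ≤F , c◁b , δ≰E)
    ... | no  c⋪b = inj₂ (δ≤F , c⋪b)
    ⊏ᴾ-total {inj₂ c} {inj₂ c′} = Cᵒ.⊏-total

    ∼ᴾ-trans : ∀ {l} x y z → dᴾ x y ≤ l → dᴾ y z ≤ l → dᴾ x z ≤ l
    ∼ᴾ-trans x y z x∼y y∼z = ≤-trans (dᴾ-triangle x y z) (∨-least x∼y y∼z)

    ⊏ᴾ-trans : ∀ {x y z} → x ⊏ᴾ y → y ⊏ᴾ z → x ⊏ᴾ z
    ⊏ᴾ-trans {inj₁ b₁} {inj₁ b₂} {inj₁ b₃} b₁⊏b₂ b₂⊏b₃ = Bᵒ.⊏-trans b₁⊏b₂ b₂⊏b₃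
    ⊏ᴾ-trans {inj₁ b₁} {inj₁ b₂} {inj₂ c} b₁⊏b₂ (δ₂≤F , c⋪b₂) =
      ∼ᴾ-trans (inj₁ b₁) (inj₁ b₂) (inj₂ c) (Bᵒ.⊏⇒≤F b₁⊏b₂) δ₂≤F ,
      λ c◁b₁ → c⋪b₂ (◁-⊑ᴮ c◁b₁ (inj₁ b₁⊏b₂))
    ⊏ᴾ-trans {inj₁ b} {inj₂ c₁} {inj₂ c₂} (δ₁≤F , c₁⋪b) c₁⊏c₂ =
      ∼ᴾ-trans (inj₁ b) (inj₂ c₁) (inj₂ c₂) δ₁≤F (Cᵒ.⊏⇒≤F c₁⊏c₂) ,
      λ c₂◁b → c₁⋪b (⊑ᶜ-◁ (inj₁ c₁⊏c₂) c₂◁b)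
    ⊏ᴾ-trans {inj₂ c₁} {inj₂ c₂} {inj₁ b} c₁⊏c₂ (δ₂≤F , c₂◁b , _) =
      ∼ᴾ-trans (inj₂ c₁) (inj₂ c₂) (inj₁ b) (Cᵒ.⊏⇒≤F c₁⊏c₂) δ₂≤F ,
      ⊑ᶜ-◁ (inj₁ c₁⊏c₂) c₂◁b , ⊏ᶜ-◁⇒δ≰E c₁⊏c₂ c₂◁b
    ⊏ᴾ-trans {inj₂ c} {inj₁ b₁} {inj₁ b₂} (δ₁≤F , c◁b₁ , _) b₁⊏b₂ =
      ∼ᴾ-trans (inj₂ c) (inj₁ b₁) (inj₁ b₂) δ₁≤F (Bᵒ.⊏⇒≤F b₁⊏b₂) ,
      ◁-⊑ᴮ c◁b₁ (inj₁ b₁⊏b₂) , ◁-⊏ᴮ⇒δ≰E c◁b₁ b₁⊏b₂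
    ⊏ᴾ-trans {inj₁ b₁} {inj₂ c} {inj₁ b₂} (δ₁≤F , c⋪b₁) (δ₂≤F , c◁b₂ , _)
      with Bᵒ.⊏-or-⊒ (∼ᴾ-trans (inj₁ b₁) (inj₂ c) (inj₁ b₂) δ₁≤F δ₂≤F)
    ... | inj₁ b₁⊏b₂ = b₁⊏b₂
    ... | inj₂ b₂⊑b₁ = ⊥-elim (c⋪b₁ (◁-⊑ᴮ c◁b₂ b₂⊑b₁))
    ⊏ᴾ-trans {inj₂ c₁} {inj₁ b} {inj₂ c₂} (δ₁≤F , c₁◁b , _) (δ₂≤F , c₂⋪b)
      with Cᵒ.⊏-or-⊒ (∼ᴾ-trans (inj₂ c₁) (inj₁ b) (inj₂ c₂) δ₁≤F δ₂≤F)
    ... | inj₁ c₁⊏c₂ = c₁⊏c₂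
    ... | inj₂ c₂⊑c₁ = ⊥-elim (c₂⋪b (⊑ᶜ-◁ c₂⊑c₁ c₁◁b))
    ⊏ᴾ-trans {inj₂ c₁} {inj₂ c₂} {inj₂ c₃} c₁⊏c₂ c₂⊏c₃ = Cᵒ.⊏-trans c₁⊏c₂ c₂⊏c₃

    isOrderedPseudoUltrametricᴾ : IsOrderedPseudoUltrametric E F dᴾ _⊏ᴾ_
    isOrderedPseudoUltrametricᴾ = record
      { d-sym = dᴾ-sym ; d-refl = dᴾ-refl ; d-triangle = dᴾ-triangle
      ; ⊏-irrefl = ⊏ᴾ-irrefl ; ⊏-trans = ⊏ᴾ-trans ; ⊏⇒≤F = ⊏ᴾ⇒≤F ; ⊏-total = ⊏ᴾ-total }

    open QuotientStructure E≤F (splitAt nB) (join nB nC) (splitAt-join nB nC)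
                           isOrderedPseudoUltrametricᴾ _⊏ᴾ?_ public
      using (D; D∈𝒜*)

    open QuotientStructure E≤F (splitAt nB) (join nB nC) (splitAt-join nB nC)
                           isOrderedPseudoUltrametricᴾ _⊏ᴾ?_
      using ([_]; []-sound; []-complete; d-[]; lt-[])

    B↪D : Emb Λ B D
    B↪D = record
      { f       = λ b → [ inj₁ b ]
      ; inj     = λ {b} {b′} [b]≡[b′] → proj₁ (proj₂ (proj₁ B∈𝒜*)) b b′ ([]-sound {inj₁ b} {inj₁ b′} [b]≡[b′])
      ; d-pres  = λ b b′ → d-[] (inj₁ b) (inj₁ b′)
      ; lt-pres = λ b b′ → trans (lt-[] (inj₁ b) (inj₁ b′)) (does-≟-true (Str.lt B b b′)) }

    C↪D : Emb Λ C D
    C↪D = record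
      { f       = λ c → [ inj₂ c ]
      ; inj     = λ {c} {c′} [c]≡[c′] → proj₁ (proj₂ (proj₁ C∈𝒜*)) c c′ ([]-sound {inj₂ c} {inj₂ c′} [c]≡[c′])
      ; d-pres  = λ c c′ → d-[] (inj₂ c) (inj₂ c′)
      ; lt-pres = λ c c′ → trans (lt-[] (inj₂ c) (inj₂ c′)) (does-≟-true (Str.lt C c c′)) }

    square-commutes : ∀ a → Emb.f B↪D (φ a) ≡ Emb.f C↪D (ψ a)
    square-commutes a = []-complete {inj₁ (φ a)} {inj₂ (ψ a)} λ l → ≤-trans (δ≤ (φ a) (ψ a) a) (∨-least (Bᵒ.d-refl (φ a) l) (Cᵒ.d-refl (ψ a) l))

  ∅ : Str Λ
  ∅ = record { n = 0 ; d = λ () ; lt = λ () }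

  ∅∈𝒜* : ∀ {E F} → 𝒜* Λ E F ∅
  ∅∈𝒜* = ((λ ()) , (λ ()) , (λ ()) , (λ ())) , ((λ ()) , (λ ()) , (λ ()) , (λ ()) , (λ ()))

  ∅↪ : ∀ X → Emb Λ ∅ X
  ∅↪ X = record { f = λ () ; inj = λ { {()} } ; d-pres = λ () ; lt-pres = λ () }

  𝒜*-closedUnderIso : ∀ {E F} → E ≤ F → ClosedUnderIso Λ (𝒜* Λ E F)
  𝒜*-closedUnderIso E≤F A B (e , surjective) =
    𝒜*-pullback E≤F B A e⁻¹ e⁻¹-injective
      (λ y y′ → Eq.trans (Eq.reflexive (cong₂ (Str.d B) (sym (e∘e⁻¹ y)) (sym (e∘e⁻¹ y′)))) (d-pres (e⁻¹ y) (e⁻¹ y′)))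
      (λ y y′ → trans (cong₂ (Str.lt B) (sym (e∘e⁻¹ y)) (sym (e∘e⁻¹ y′))) (lt-pres (e⁻¹ y) (e⁻¹ y′)))
    where
    open Emb e
    e⁻¹ : Fin (Str.n B) → Fin (Str.n A)
    e⁻¹ y = proj₁ (surjective y)
    e∘e⁻¹ : ∀ y → f (e⁻¹ y) ≡ y
    e∘e⁻¹ y = proj₂ (surjective y)
    e⁻¹-injective : Injective _≡_ _≡_ e⁻¹
    e⁻¹-injective {y} {y′} e⁻¹y≡e⁻¹y′ = trans (sym (e∘e⁻¹ y)) (trans (cong f e⁻¹y≡e⁻¹y′) (e∘e⁻¹ y′))

  𝒜*-hereditary : ∀ {E F} → E ≤ F → Hereditary Λ (𝒜* Λ E F)
  𝒜*-hereditary E≤F A B e =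
    𝒜*-pullback E≤F A B f inj (λ x x′ → Eq.sym (d-pres x x′)) (λ x x′ → sym (lt-pres x x′))
    where open Emb e

  𝒜*-AP : ∀ {E F} → MeetIrreducible Λ E → E ≤ F → AP Λ (𝒜* Λ E F)
  𝒜*-AP E-irr E≤F A B C _ B∈𝒜* C∈𝒜* f g = D , D∈𝒜* , B↪D , C↪D , square-commutes
    where open Amalgamation E-irr E≤F A B C B∈𝒜* C∈𝒜* f g

  AP⇒JEP : ∀ {K : Class Λ} → K ∅ → AP Λ K → JEP Λ K
  AP⇒JEP ∅∈K K-AP B C B∈K C∈K =
    let D , D∈K , B↪D , C↪D , _ = K-AP ∅ B C ∅∈K B∈K C∈K (∅↪ B) (∅↪ C)
    in D , D∈K , B↪D , C↪D

lemmaA4 : (Λ : FiniteDistLattice) (E F : FiniteDistLattice.Carrier Λ) →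
    MeetIrreducible Λ E → FiniteDistLattice._≤_ Λ E F →
    IsAmalgamationClass Λ (𝒜* Λ E F)
lemmaA4 Λ E F E-irr E≤F =
  𝒜*-closedUnderIso Λ E≤F , 𝒜*-hereditary Λ E≤F , AP⇒JEP Λ (∅∈𝒜* Λ) (𝒜*-AP Λ E-irr E≤F) , 𝒜*-AP Λ E-irr E≤F
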